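{- Let $\mu$ be a partition and $g$ a real-valued function of partitions. Let $A(n)=\sum_{|\lambda/\mu|=n}f_{\lambda/\mu}g(\lambda)$ and $B(n)=\sum_{|\lambda/\mu|=n}f_{\lambda/\mu}Dg(\lambda)$. Then for every nonnegative integer $n$, $A(n)=A(0)+\sum_{k=0}^{n-1}B(k)$.
   Context: The sum over $|\lambda/\mu|=n$ ranges over partitions $\lambda\supseteq\mu$ with $|\lambda|-|\mu|=n$; $f_{\lambda/\mu}$ is the number of standard Young tableaux of skew shape $\lambda/\mu$, with $f_{\mu/\mu}=1$. For a function $g$ on partitions, $Dg(\lambda)=\sum_{\lambda^+}g(\lambda^+)-g(\lambda)$, where $\lambda^+$ ranges over all partitions obtained from $\lambda$ by adding one box. -}

module Defs where

open import Level using (Level)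
open import Data.Bool using (Bool; true; false; _∧_; if_then_else_)
open import Data.Nat using (ℕ; zero; suc; _∸_; _<_; _≥_; _≤ᵇ_; _≡ᵇ_; _⊓_)
import Data.Nat as ℕ
open import Data.List using (List; []; _∷_; [_]; map; concatMap; filterᵇ; length; upTo)
open import Data.Nat.ListAction using (sum)
open import Data.List.Properties using (≡-dec)
open import Data.List.Relation.Unary.All using (All)
open import Data.List.Relation.Unary.Linked using (Linked)
open import Relation.Nullary.Decidable using (⌊_⌋)
open import Algebra.Bundles using (CommutativeRing)

IsPartition : List ℕ → Set
IsPartition μ = Linked _≥_ μ × All (λ x → 0 < x) μ
  where open import Data.Product using (_×_)

size : List ℕ → ℕ
size = sum

-- containment μ ⊆ λ (parts compared with zero padding)
_⊆ᵇ_ : List ℕ → List ℕ → Bool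
[] ⊆ᵇ _ = true
(x ∷ xs) ⊆ᵇ [] = (x ≡ᵇ 0) ∧ (xs ⊆ᵇ [])
(x ∷ xs) ⊆ᵇ (y ∷ ys) = (x ≤ᵇ y) ∧ (xs ⊆ᵇ ys)

-- partitions of n with all parts ≤ b (fuel-driven; fuel ≥ n suffices)
partsB : ℕ → ℕ → ℕ → List (List ℕ)
partsB _ _ zero = [ [] ]
partsB zero _ (suc n) = []
partsB (suc fuel) b (suc n) =
  concatMap (λ k → map (suc k ∷_) (partsB fuel (suc k) (suc n ∸ suc k)))
            (upTo (b ⊓ suc n))

partitions : ℕ → List (List ℕ)
partitions n = partsB n n n

addBox : List ℕ → List (List ℕ)
addBox λ′ = filterᵇ (λ ν → λ′ ⊆ᵇ ν) (partitions (suc (size λ′)))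

-- endpoints (with multiplicity) of all saturated chains
-- μ = λ⁰ ⊂ λ¹ ⊂ ... ⊂ λⁿ in Young's lattice, each step adding one box
chainEnds : ℕ → List ℕ → List (List ℕ)
chainEnds zero μ = [ μ ]
chainEnds (suc n) μ = concatMap addBox (chainEnds n μ)

_==_ : List ℕ → List ℕ → Bool
a == b = ⌊ ≡-dec ℕ._≟_ a b ⌋

-- f_{λ/μ}: number of standard Young tableaux of skew shape λ/μ,
-- i.e. number of saturated chains from μ to λ (f_{μ/μ} = 1).
syt : List ℕ → List ℕ → ℕ
syt λ′ μ = length (filterᵇ (λ ν → ν == λ′) (chainEnds (size λ′ ∸ size μ) μ))

skewShapes : List ℕ → ℕ → List (List ℕ)
skewShapes μ n = filterᵇ (λ ν → μ ⊆ᵇ ν) (partitions (size μ ℕ.+ n))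

module WithRing {c ℓ : Level} (R : CommutativeRing c ℓ) where
  open CommutativeRing R

  _·_ : ℕ → Carrier → Carrier
  zero · x = 0#
  suc n · x = x + (n · x)

  Σ : List Carrier → Carrier
  Σ [] = 0#
  Σ (x ∷ xs) = x + Σ xs

  Σ< : ℕ → (ℕ → Carrier) → Carrier
  Σ< zero h = 0#
  Σ< (suc n) h = Σ< n h + h n

  D : (List ℕ → Carrier) → List ℕ → Carrier
  D g λ′ = Σ (map g (addBox λ′)) - g λ′

  skewSum : List ℕ → (List ℕ → Carrier) → ℕ → Carrier
  skewSum μ h n = Σ (map (λ λ′ → syt λ′ μ · h λ′) (skewShapes μ n))

  A : List ℕ → (List ℕ → Carrier) → ℕ → Carrier
  A μ g n = skewSum μ g n

  B : List ℕ → (List ℕ → Carrier) → ℕ → Carrier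
  B μ g n = skewSum μ (D g) n

module Submission where

-- Write Cₙ = chainEnds n μ for the list (with multiplicity) of endpoints of
-- saturated chains of length n starting at μ, so that f_{λ/μ} is the
-- multiplicity of λ in Cₙ.
--
-- 1. Enumeration.  partitions m lists every partition of m exactly once and
--    nothing else; every element of Cₙ is a partition λ ⊇ μ with |λ/μ| = n.
--    Hence every element of Cₙ occurs exactly once in skewShapes μ n.
-- 2. Reindexing.  If every element of a list C occurs exactly once in L, then
--    Σ_{λ∈L} mult(λ,C)·h(λ) = Σ_{c∈C} h(c); so the skew sum
--    Σ_{|λ/μ|=n} f_{λ/μ} h(λ) equals the sum of h over Cₙ.
-- 3. Telescoping.  Since C_{n+1} is obtained by adding a box to each element
--    of Cₙ in all ways, Σ_{C_{n+1}} g = Σ_{c∈Cₙ} (g(c) + Dg(c)), that is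
--    A(n+1) = A(n) + B(n); induction on n gives the theorem.

open import Defs
open import Level using (Level)
open import Data.Nat using (ℕ; zero; suc; _∸_; _<_; _≤_; _≥_; _≤ᵇ_; _≡ᵇ_; _⊓_; z≤n; s≤s)
import Data.Nat as ℕ
open import Data.Nat.Properties
  using (≤ᵇ⇒≤; ≤⇒≤ᵇ; ≡ᵇ⇒≡; ≡⇒≡ᵇ; ≤-refl; ≤-trans; n≤0⇒n≡0; m≤m+n; m≤n+m; m+n∸m≡n; m+[n∸m]≡n;
         m<n⊓o⇒m<n; m<n⊓o⇒m<o; ⊓-glb; +-suc; suc-injective)
  renaming (+-identityʳ to +-identityʳ-ℕ)
open import Data.Bool using (Bool; true; false; _∧_; T)
open import Data.Bool.Properties using (T-∧)
open import Data.Unit using (⊤; tt)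
open import Data.Product using (_×_; _,_; proj₁; proj₂)
open import Data.Sum using (_⊎_; inj₁; inj₂)
open import Data.List using (List; []; _∷_; [_]; _++_; map; concatMap; filterᵇ; length; upTo; applyUpTo)
open import Data.List.Properties
  using (≡-dec; filter-++; length-++; filter-accept; filter-reject; map-applyUpTo; ∷-injectiveˡ; ∷-injectiveʳ)
open import Data.Nat.ListAction using (sum)
open import Data.List.Relation.Unary.All using (All; []; _∷_)
import Data.List.Relation.Unary.All as All
open import Data.List.Relation.Unary.All.Properties using (map⁺; concat⁺; all-upTo; all-filter; filter⁺)
open import Data.List.Relation.Unary.Linked using (Linked; []; [-]; _∷_)
open import Function using (_∘_)
open import Function.Bundles using (Equivalence)
open import Relation.Binary.PropositionalEquality
  using (_≡_; _≢_; refl; sym; trans; cong; subst; module ≡-Reasoning)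
open import Relation.Nullary using (yes; no)
open import Relation.Nullary.Decidable using (T?; toWitness; fromWitness)
open import Algebra.Bundles using (CommutativeRing)

_⊆_ : List ℕ → List ℕ → Set
a ⊆ b = T (a ⊆ᵇ b)

∧-split : ∀ {a b} → T (a ∧ b) → T a × T b
∧-split = Equivalence.to T-∧

∧-pair : ∀ {a b} → T a → T b → T (a ∧ b)
∧-pair ta tb = Equivalence.from T-∧ (ta , tb)

-- A list contained in [] consists of zeros, so it is contained in anything.
⊆[]⇒⊆ : ∀ a c → a ⊆ [] → a ⊆ c
⊆[]⇒⊆ []       c        _ = tt
⊆[]⇒⊆ (x ∷ xs) []       h = h
⊆[]⇒⊆ (x ∷ xs) (y ∷ ys) h with ∧-split {x ≡ᵇ 0} h
... | x≡ᵇ0 , xs⊆[] rewrite ≡ᵇ⇒≡ x 0 x≡ᵇ0 = ∧-pair {0 ≤ᵇ y} (≤⇒≤ᵇ (z≤n {y})) (⊆[]⇒⊆ xs ys xs⊆[])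

⊆-refl : ∀ a → a ⊆ a
⊆-refl []       = tt
⊆-refl (x ∷ xs) = ∧-pair {x ≤ᵇ x} (≤⇒≤ᵇ (≤-refl {x})) (⊆-refl xs)

⊆-trans : ∀ a b c → a ⊆ b → b ⊆ c → a ⊆ c
⊆-trans []       _        _        _  _  = tt
⊆-trans (x ∷ xs) []       c        h₁ _  = ⊆[]⇒⊆ (x ∷ xs) c h₁
⊆-trans (x ∷ xs) (y ∷ ys) []       h₁ h₂ with ∧-split {x ≤ᵇ y} h₁ | ∧-split {y ≡ᵇ 0} h₂
... | x≤ᵇy , xs⊆ys | y≡ᵇ0 , ys⊆[] =
  ∧-pair {x ≡ᵇ 0} (≡⇒≡ᵇ x 0 x≡0) (⊆-trans xs ys [] xs⊆ys ys⊆[])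
  where
  x≡0 : x ≡ 0
  x≡0 = n≤0⇒n≡0 (subst (x ≤_) (≡ᵇ⇒≡ y 0 y≡ᵇ0) (≤ᵇ⇒≤ x y x≤ᵇy))
⊆-trans (x ∷ xs) (y ∷ ys) (z ∷ zs) h₁ h₂ with ∧-split {x ≤ᵇ y} h₁ | ∧-split {y ≤ᵇ z} h₂
... | x≤ᵇy , xs⊆ys | y≤ᵇz , ys⊆zs =
  ∧-pair {x ≤ᵇ z} (≤⇒≤ᵇ (≤-trans (≤ᵇ⇒≤ x y x≤ᵇy) (≤ᵇ⇒≤ y z y≤ᵇz))) (⊆-trans xs ys zs xs⊆ys ys⊆zs)

-- Case split on equality of two lists, phrased as a sum so that splitting on it
-- does not abstract the decision procedure hidden inside occ.
same-or-different : (a b : List ℕ) → a ≡ b ⊎ a ≢ b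
same-or-different a b with ≡-dec ℕ._≟_ a b
... | yes a≡b = inj₁ a≡b
... | no  a≢b = inj₂ a≢b

-- occ x L: the number of occurrences of x in L.  By definition
-- syt λ μ = occ λ (chainEnds (size λ ∸ size μ) μ).
occ : List ℕ → List (List ℕ) → ℕ
occ x L = length (filterᵇ (λ ν → ν == x) L)

occ-here : ∀ x L → occ x (x ∷ L) ≡ suc (occ x L)
occ-here x L = cong length (filter-accept (λ ν → T? (ν == x)) (fromWitness {a? = ≡-dec ℕ._≟_ x x} refl))

occ-there : ∀ {x y} L → y ≢ x → occ x (y ∷ L) ≡ occ x L
occ-there {x} {y} L y≢x =
  cong length (filter-reject (λ ν → T? (ν == x)) (y≢x ∘ toWitness {a? = ≡-dec ℕ._≟_ y x}))

occ-++ : ∀ x A B → occ x (A ++ B) ≡ occ x A ℕ.+ occ x B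
occ-++ x A B =
  trans (cong length (filter-++ (λ ν → T? (ν == x)) A B)) (length-++ (filterᵇ (λ ν → ν == x) A))

occ-concatMap : ∀ {I : Set} x (F : I → List (List ℕ)) K →
                occ x (concatMap F K) ≡ sum (map (λ k → occ x (F k)) K)
occ-concatMap x F []      = refl
occ-concatMap x F (k ∷ K) =
  trans (occ-++ x (F k) (concatMap F K)) (cong (occ x (F k) ℕ.+_) (occ-concatMap x F K))

occ-map-injective : ∀ (f : List ℕ → List ℕ) → (∀ {a b} → f a ≡ f b → a ≡ b) →
                    ∀ x L → occ (f x) (map f L) ≡ occ x L
occ-map-injective f inj x []      = refl
occ-map-injective f inj x (y ∷ L) with same-or-different y x
... | inj₁ refl =
  trans (occ-here (f y) (map f L)) (trans (cong suc (occ-map-injective f inj y L)) (sym (occ-here y L)))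
... | inj₂ y≢x =
  trans (occ-there (map f L) (y≢x ∘ inj)) (trans (occ-map-injective f inj x L) (sym (occ-there L y≢x)))

occ-map-outside : ∀ (f : List ℕ → List ℕ) y → (∀ z → f z ≢ y) → ∀ L → occ y (map f L) ≡ 0
occ-map-outside f y out []      = refl
occ-map-outside f y out (z ∷ L) = trans (occ-there (map f L) (out z)) (occ-map-outside f y out L)

occ-filter : ∀ (p : List ℕ → Bool) x → T (p x) → ∀ L → occ x (filterᵇ p L) ≡ occ x L
occ-filter p x px []      = refl
occ-filter p x px (y ∷ L) with same-or-different y x
... | inj₁ refl = trans (cong (occ y) (filter-accept (T? ∘ p) px)) (trans (occ-here y (filterᵇ p L))
                   (trans (cong suc (occ-filter p y px L)) (sym (occ-here y L))))
... | inj₂ y≢x with p y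
...   | true  = trans (occ-there (filterᵇ p L) y≢x) (trans (occ-filter p x px L) (sym (occ-there L y≢x)))
...   | false = trans (occ-filter p x px L) (sym (occ-there L y≢x))

sum-applyUpTo-zero : ∀ m (φ : ℕ → ℕ) → (∀ k → φ k ≡ 0) → sum (applyUpTo φ m) ≡ 0
sum-applyUpTo-zero zero    φ φ≡0 = refl
sum-applyUpTo-zero (suc m) φ φ≡0 rewrite φ≡0 0 = sum-applyUpTo-zero m (φ ∘ suc) (φ≡0 ∘ suc)

sum-applyUpTo-single : ∀ m (φ : ℕ → ℕ) k₀ → k₀ < m → (∀ k → k ≢ k₀ → φ k ≡ 0) →
                       sum (applyUpTo φ m) ≡ φ k₀
sum-applyUpTo-single (suc m) φ zero     _         φ≡0 =
  trans (cong (φ 0 ℕ.+_) (sum-applyUpTo-zero m (φ ∘ suc) (λ k → φ≡0 (suc k) λ ()))) (+-identityʳ-ℕ (φ 0))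
sum-applyUpTo-single (suc m) φ (suc k₀) (s≤s k₀<m) φ≡0 rewrite φ≡0 0 (λ ()) =
  sum-applyUpTo-single m (φ ∘ suc) k₀ k₀<m (λ k k≢k₀ → φ≡0 (suc k) (k≢k₀ ∘ suc-injective))

HeadAtMost : ℕ → List ℕ → Set
HeadAtMost b []      = ⊤
HeadAtMost b (y ∷ _) = y ≤ b

BoundedPartition : ℕ → ℕ → List ℕ → Set
BoundedPartition b n x = IsPartition x × size x ≡ n × HeadAtMost b x

cons-decreasing : ∀ {k} xs → Linked _≥_ xs → HeadAtMost k xs → Linked _≥_ (k ∷ xs)
cons-decreasing []      _  _   = [-]
cons-decreasing (_ ∷ _) xs↓ y≤k = y≤k ∷ xs↓

tail-decreasing : ∀ {x} xs → Linked _≥_ (x ∷ xs) → Linked _≥_ xs × HeadAtMost x xs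
tail-decreasing []      _           = [] , tt
tail-decreasing (_ ∷ _) (y≤x ∷ xs↓) = xs↓ , y≤x

partsB-sound : ∀ fuel b n → All (BoundedPartition b n) (partsB fuel b n)
partsB-sound _          b zero    = (([] , []) , refl , tt) ∷ []
partsB-sound zero       b (suc n) = []
partsB-sound (suc fuel) b (suc n) = concat⁺ (map⁺ (All.map extend-all (all-upTo (b ⊓ suc n))))
  where
  extend : ∀ {k xs} → k < b ⊓ suc n → BoundedPartition (suc k) (suc n ∸ suc k) xs →
           BoundedPartition b (suc n) (suc k ∷ xs)
  extend {k} {xs} k< ((xs↓ , xs>0) , |xs| , head≤) =
    (cons-decreasing xs xs↓ head≤ , s≤s z≤n ∷ xs>0) ,
    trans (cong (suc k ℕ.+_) |xs|) (m+[n∸m]≡n (m<n⊓o⇒m<o b (suc n) k<)) ,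
    m<n⊓o⇒m<n b (suc n) k<
  extend-all : ∀ {k} → k < b ⊓ suc n →
               All (BoundedPartition b (suc n)) (map (suc k ∷_) (partsB fuel (suc k) (suc n ∸ suc k)))
  extend-all {k} k< = map⁺ (All.map (extend k<) (partsB-sound fuel (suc k) (suc n ∸ suc k)))

partsB-complete : ∀ fuel b x → IsPartition x → HeadAtMost b x → size x ≤ fuel →
                  occ x (partsB fuel b (size x)) ≡ 1
partsB-complete fuel       b []            _                  _     _ = refl
partsB-complete fuel       b (zero ∷ xs)   (_ , (() ∷ _))     _     _
partsB-complete zero       b (suc k₀ ∷ xs) _                  _     ()
partsB-complete (suc fuel) b (suc k₀ ∷ xs) (x↓ , (_ ∷ xs>0))  k₀<b  (s≤s |x|≤) = begin
  occ x (concatMap branch (upTo (b ⊓ suc n)))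
    ≡⟨ occ-concatMap x branch (upTo (b ⊓ suc n)) ⟩
  sum (map (λ k → occ x (branch k)) (upTo (b ⊓ suc n)))
    ≡⟨ cong sum (map-applyUpTo (λ k → k) (λ k → occ x (branch k)) (b ⊓ suc n)) ⟩
  sum (applyUpTo (λ k → occ x (branch k)) (b ⊓ suc n))
    ≡⟨ sum-applyUpTo-single (b ⊓ suc n) (λ k → occ x (branch k)) k₀ k₀-in-range other-branch ⟩
  occ x (branch k₀)
    ≡⟨ occ-map-injective (suc k₀ ∷_) ∷-injectiveʳ xs (partsB fuel (suc k₀) (suc n ∸ suc k₀)) ⟩
  occ xs (partsB fuel (suc k₀) (suc n ∸ suc k₀))
    ≡⟨ cong (λ m → occ xs (partsB fuel (suc k₀) m)) (m+n∸m≡n k₀ (size xs)) ⟩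
  occ xs (partsB fuel (suc k₀) (size xs))
    ≡⟨ partsB-complete fuel (suc k₀) xs (xs↓ , xs>0) head≤ (≤-trans (m≤n+m (size xs) k₀) |x|≤) ⟩
  1 ∎
  where
  open ≡-Reasoning
  x : List ℕ
  x = suc k₀ ∷ xs
  n : ℕ
  n = k₀ ℕ.+ size xs
  -- partsB tries every first part suc k with k < b ⊓ suc n; x lies in branch k₀.
  k₀-in-range : k₀ < b ⊓ suc n
  k₀-in-range = ⊓-glb k₀<b (s≤s (m≤m+n k₀ (size xs)))
  branch : ℕ → List (List ℕ)
  branch k = map (suc k ∷_) (partsB fuel (suc k) (suc n ∸ suc k))
  other-branch : ∀ k → k ≢ k₀ → occ x (branch k) ≡ 0
  other-branch k k≢k₀ = occ-map-outside (suc k ∷_) x (λ _ e → k≢k₀ (suc-injective (∷-injectiveˡ e)))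
                          (partsB fuel (suc k) (suc n ∸ suc k))
  xs↓ : Linked _≥_ xs
  xs↓ = proj₁ (tail-decreasing xs x↓)
  head≤ : HeadAtMost (suc k₀) xs
  head≤ = proj₂ (tail-decreasing xs x↓)

partitions-sound : ∀ m → All (λ x → IsPartition x × size x ≡ m) (partitions m)
partitions-sound m = All.map (λ (x-partition , |x| , _) → x-partition , |x|) (partsB-sound m m m)

partitions-complete : ∀ x → IsPartition x → occ x (partitions (size x)) ≡ 1
partitions-complete x x-partition = partsB-complete (size x) (size x) x x-partition (head≤size x) ≤-refl
  where
  head≤size : ∀ y → HeadAtMost (size y) y
  head≤size []      = tt
  head≤size (y ∷ ys) = m≤m+n y (size ys)

All-filterᵇ : ∀ {P Q : List ℕ → Set} (p : List ℕ → Bool) {L} → (∀ {x} → P x → T (p x) → Q x) →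
              All P L → All Q (filterᵇ p L)
All-filterᵇ p {L} both Ps =
  All.zipWith (λ (Px , px) → both Px px) (filter⁺ (T? ∘ p) Ps , all-filter (T? ∘ p) L)

IsSkewShape : List ℕ → ℕ → List ℕ → Set
IsSkewShape μ n ν = IsPartition ν × size ν ≡ size μ ℕ.+ n × μ ⊆ ν

addBox-skewShape : ∀ μ n {λ′} → IsSkewShape μ n λ′ → All (IsSkewShape μ (suc n)) (addBox λ′)
addBox-skewShape μ n {λ′} (_ , |λ′| , μ⊆λ′) =
  All-filterᵇ (λ ν → λ′ ⊆ᵇ ν)
    (λ {ν} (ν-partition , |ν|) λ′⊆ν →
       ν-partition ,
       trans |ν| (trans (cong suc |λ′|) (sym (+-suc (size μ) n))) ,
       ⊆-trans μ λ′ ν μ⊆λ′ λ′⊆ν)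
    (partitions-sound (suc (size λ′)))

chainEnds-skewShape : ∀ μ → IsPartition μ → ∀ n → All (IsSkewShape μ n) (chainEnds n μ)
chainEnds-skewShape μ μ-partition zero    = (μ-partition , sym (+-identityʳ-ℕ (size μ)) , ⊆-refl μ) ∷ []
chainEnds-skewShape μ μ-partition (suc n) =
  concat⁺ (map⁺ (All.map (addBox-skewShape μ n) (chainEnds-skewShape μ μ-partition n)))

chainEnds-occur-once : ∀ μ → IsPartition μ → ∀ n → All (λ ν → occ ν (skewShapes μ n) ≡ 1) (chainEnds n μ)
chainEnds-occur-once μ μ-partition n = All.map occurs-once (chainEnds-skewShape μ μ-partition n)
  where
  occurs-once : ∀ {ν} → IsSkewShape μ n ν → occ ν (skewShapes μ n) ≡ 1
  occurs-once {ν} (ν-partition , |ν| , μ⊆ν) =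
    trans (occ-filter (λ ν → μ ⊆ᵇ ν) ν μ⊆ν (partitions (size μ ℕ.+ n)))
          (subst (λ m → occ ν (partitions m) ≡ 1) |ν| (partitions-complete ν ν-partition))

skewShapes-size : ∀ μ n → All (λ ν → size ν ∸ size μ ≡ n) (skewShapes μ n)
skewShapes-size μ n =
  All-filterᵇ (λ ν → μ ⊆ᵇ ν) (λ (_ , |ν|) _ → trans (cong (_∸ size μ) |ν|) (m+n∸m≡n (size μ) n))
    (partitions-sound (size μ ℕ.+ n))

module RingSums {c ℓ : Level} (R : CommutativeRing c ℓ) where
  open CommutativeRing R renaming (refl to ≈-refl; sym to ≈-sym; trans to ≈-trans)
  open WithRing R
  open import Relation.Binary.Reasoning.Setoid setoid
  open import Algebra.Properties.CommutativeSemigroup +-commutativeSemigroup using (interchange)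
  open import Algebra.Properties.Group +-group using (//-rightDividesˡ)

  sumOver : {A : Set} → (A → Carrier) → List A → Carrier
  sumOver h L = Σ (map h L)

  sumOver-cong : ∀ {A : Set} {h k : A → Carrier} {L} → All (λ a → h a ≈ k a) L →
                 sumOver h L ≈ sumOver k L
  sumOver-cong []       = ≈-refl
  sumOver-cong (e ∷ es) = +-cong e (sumOver-cong es)

  sumOver-++ : ∀ {A : Set} (h : A → Carrier) L M → sumOver h (L ++ M) ≈ sumOver h L + sumOver h M
  sumOver-++ h []      M = ≈-sym (+-identityˡ _)
  sumOver-++ h (a ∷ L) M = ≈-trans (+-congˡ (sumOver-++ h L M)) (≈-sym (+-assoc _ _ _))

  sumOver-concatMap : ∀ {A B : Set} (h : B → Carrier) (F : A → List B) L →
                      sumOver h (concatMap F L) ≈ sumOver (λ a → sumOver h (F a)) L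
  sumOver-concatMap h F []      = ≈-refl
  sumOver-concatMap h F (a ∷ L) =
    ≈-trans (sumOver-++ h (F a) (concatMap F L)) (+-congˡ (sumOver-concatMap h F L))

  sumOver-+ : ∀ {A : Set} (h k : A → Carrier) L → sumOver (λ a → h a + k a) L ≈ sumOver h L + sumOver k L
  sumOver-+ h k []      = ≈-sym (+-identityˡ 0#)
  sumOver-+ h k (a ∷ L) = ≈-trans (+-congˡ (sumOver-+ h k L)) (interchange _ _ _ _)

  sumOver-zero : ∀ {A : Set} (L : List A) → sumOver (λ _ → 0#) L ≈ 0#
  sumOver-zero []      = ≈-refl
  sumOver-zero (_ ∷ L) = ≈-trans (+-identityˡ _) (sumOver-zero L)

  ·-distrib-+ : ∀ m n x → (m ℕ.+ n) · x ≈ (m · x) + (n · x)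
  ·-distrib-+ zero    n x = ≈-sym (+-identityˡ _)
  ·-distrib-+ (suc m) n x = ≈-trans (+-congˡ (·-distrib-+ m n x)) (≈-sym (+-assoc _ _ _))

  sumOver-occ-single : ∀ (h : List ℕ → Carrier) x L → sumOver (λ l → occ l [ x ] · h l) L ≈ occ x L · h x
  sumOver-occ-single h x []      = ≈-refl
  sumOver-occ-single h x (l ∷ L) with same-or-different l x
  ... | inj₁ refl = begin
    occ l [ l ] · h l + rest
      ≡⟨ cong (λ m → m · h l + rest) (occ-here l []) ⟩
    (h l + 0#) + rest
      ≈⟨ +-cong (+-identityʳ (h l)) (sumOver-occ-single h l L) ⟩
    h l + occ l L · h l
      ≡⟨ cong (_· h l) (occ-here l L) ⟨
    occ l (l ∷ L) · h l ∎
    where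
    rest : Carrier
    rest = sumOver (λ l′ → occ l′ [ l ] · h l′) L
  ... | inj₂ l≢x = begin
    occ l [ x ] · h l + rest
      ≡⟨ cong (λ m → m · h l + rest) (occ-there [] (l≢x ∘ sym)) ⟩
    0# + rest
      ≈⟨ +-identityˡ rest ⟩
    rest
      ≈⟨ sumOver-occ-single h x L ⟩
    occ x L · h x
      ≡⟨ cong (_· h x) (occ-there L l≢x) ⟨
    occ x (l ∷ L) · h x ∎
    where
    rest : Carrier
    rest = sumOver (λ l′ → occ l′ [ x ] · h l′) L

  sumOver-multiplicity : ∀ (h : List ℕ → Carrier) L C → All (λ c → occ c L ≡ 1) C →
                         sumOver (λ l → occ l C · h l) L ≈ sumOver h C
  sumOver-multiplicity h L []      []               = sumOver-zero L
  sumOver-multiplicity h L (x ∷ C) (x-once ∷ once) = begin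
    sumOver (λ l → occ l (x ∷ C) · h l) L
      ≈⟨ sumOver-cong (All.universal (λ l → reflexive (cong (_· h l) (occ-++ l [ x ] C))) L) ⟩
    sumOver (λ l → (occ l [ x ] ℕ.+ occ l C) · h l) L
      ≈⟨ sumOver-cong (All.universal (λ l → ·-distrib-+ (occ l [ x ]) (occ l C) (h l)) L) ⟩
    sumOver (λ l → occ l [ x ] · h l + occ l C · h l) L
      ≈⟨ sumOver-+ (λ l → occ l [ x ] · h l) (λ l → occ l C · h l) L ⟩
    sumOver (λ l → occ l [ x ] · h l) L + sumOver (λ l → occ l C · h l) L
      ≈⟨ +-cong (sumOver-occ-single h x L) (sumOver-multiplicity h L C once) ⟩
    occ x L · h x + sumOver h C
      ≡⟨ cong (λ m → m · h x + sumOver h C) x-once ⟩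
    (h x + 0#) + sumOver h C
      ≈⟨ +-congʳ (+-identityʳ (h x)) ⟩
    h x + sumOver h C ∎

  -- The skew sum Σ_{|λ/μ|=n} f_{λ/μ} h(λ) is the sum of h over the chain ends Cₙ:
  -- on a listed shape ν, |ν/μ| = n, so f_{ν/μ} is the multiplicity of ν in Cₙ.
  skewSum-chainEnds : ∀ μ → IsPartition μ → ∀ h n → skewSum μ h n ≈ sumOver h (chainEnds n μ)
  skewSum-chainEnds μ μ-partition h n = ≈-trans
    (sumOver-cong (All.map syt-as-occ (skewShapes-size μ n)))
    (sumOver-multiplicity h (skewShapes μ n) (chainEnds n μ) (chainEnds-occur-once μ μ-partition n))
    where
    syt-as-occ : ∀ {ν} → size ν ∸ size μ ≡ n → syt ν μ · h ν ≈ occ ν (chainEnds n μ) · h ν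
    syt-as-occ {ν} |ν/μ| = reflexive (cong (λ m → occ ν (chainEnds m μ) · h ν) |ν/μ|)

  addBox-sum : ∀ g λ′ → sumOver g (addBox λ′) ≈ g λ′ + D g λ′
  addBox-sum g λ′ = ≈-trans (≈-sym (//-rightDividesˡ (g λ′) (sumOver g (addBox λ′)))) (+-comm _ _)

  A-step : ∀ μ → IsPartition μ → ∀ g n → A μ g (suc n) ≈ A μ g n + B μ g n
  A-step μ μ-partition g n = begin
    A μ g (suc n)
      ≈⟨ skewSum-chainEnds μ μ-partition g (suc n) ⟩
    sumOver g (concatMap addBox Cₙ)
      ≈⟨ sumOver-concatMap g addBox Cₙ ⟩
    sumOver (λ λ′ → sumOver g (addBox λ′)) Cₙ
      ≈⟨ sumOver-cong (All.universal (addBox-sum g) Cₙ) ⟩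
    sumOver (λ λ′ → g λ′ + D g λ′) Cₙ
      ≈⟨ sumOver-+ g (D g) Cₙ ⟩
    sumOver g Cₙ + sumOver (D g) Cₙ
      ≈⟨ +-cong (≈-sym (skewSum-chainEnds μ μ-partition g n)) (≈-sym (skewSum-chainEnds μ μ-partition (D g) n)) ⟩
    A μ g n + B μ g n ∎
    where
    Cₙ : List (List ℕ)
    Cₙ = chainEnds n μ

lemma3p1 : {c ℓ : Level} (R : CommutativeRing c ℓ) (μ : List ℕ) → IsPartition μ →
           (g : List ℕ → CommutativeRing.Carrier R) → (n : ℕ) →
           CommutativeRing._≈_ R (WithRing.A R μ g n)
             (CommutativeRing._+_ R (WithRing.A R μ g 0)
               (WithRing.Σ< R n (λ k → WithRing.B R μ g k)))
lemma3p1 R μ μ-partition g zero    = ≈-sym (+-identityʳ (A μ g 0))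
  where
  open CommutativeRing R using (+-identityʳ) renaming (sym to ≈-sym)
  open WithRing R using (A)
lemma3p1 R μ μ-partition g (suc n) = begin
  A μ g (suc n)                        ≈⟨ A-step μ μ-partition g n ⟩
  A μ g n + B μ g n                    ≈⟨ +-congʳ (lemma3p1 R μ μ-partition g n) ⟩
  (A μ g 0 + Σ< n (B μ g)) + B μ g n   ≈⟨ +-assoc _ _ _ ⟩
  A μ g 0 + Σ< (suc n) (B μ g)         ∎
  where
  open CommutativeRing R using (_+_; +-congʳ; +-assoc; setoid)
  open WithRing R using (A; B; Σ<)
  open RingSums R using (A-step)
  open import Relation.Binary.Reasoning.Setoid setoid
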